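{- Let $P$ be a finite path (word in the letters $L$, $R$) starting at the root of the Calkin–Wilf tree, identified with the positive rational labeling the vertex it reaches. Then for every positive integer $n$: (1) $?(PR^n)=n+?(P)$; (2) $?(PL^{n+1})=\frac{1}{2^n}\,?(PL)$; (3) $?(PLR^nL)=1-2^{ -n}+2^{ -(n+1)}\,?(PL)$.
   Context: The Calkin–Wilf tree is the rooted infinite binary tree whose vertices are labeled by fractions: the root is $\frac{1}{1}$, and a vertex labeled $\frac{a}{b}$ has left child $\frac{a}{a+b}$ and right child $\frac{a+b}{b}$. Every positive rational appears exactly once. A path is a word in $\{L,R\}$, read from the root, where $L$ means "go to the left child" and $R$ means "go to the right child"; $PR^n$ denotes $P$ followed by $n$ letters $R$, etc. The Minkowski question-mark function is defined on rationals by $?(y)=a_0+2\sum_{k=1}^{m}\frac{(-1)^{k+1}}{2^{a_1+\cdots+a_k}}$, where $y=[a_0;a_1,\ldots,a_m]$ is a finite simple continued fraction of $y$ ($a_0\in\mathbb{Z}$, $a_1,\ldots,a_m$ positive integers). -}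

module Defs where

open import Data.Nat as ℕ using (ℕ; zero; suc)
open import Data.Nat.DivMod using (_/_; _%_)
open import Data.List using (List; []; _∷_)
open import Data.Product using (_×_; _,_)
open import Data.Rational as ℚ using (ℚ; 0ℚ; 1ℚ; ½)
open import Data.Integer using (+_)

ℕtoℚ : ℕ → ℚ
ℕtoℚ n = (+ n) ℚ./ 1

data Letter : Set where
  L R : Letter

Path : Set
Path = List Letter

-- Label of the vertex reached by a path, as a pair (numerator , denominator).
-- Root is 1/1; a/b has left child a/(a+b) and right child (a+b)/b.
step : ℕ × ℕ → Letter → ℕ × ℕ
step (a , b) L = (a , a ℕ.+ b)
step (a , b) R = (a ℕ.+ b , b)

labelFrom : ℕ × ℕ → Path → ℕ × ℕ
labelFrom v []       = v
labelFrom v (x ∷ xs) = labelFrom (step v x) xs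

label : Path → ℕ × ℕ
label = labelFrom (1 , 1)

-- Simple continued fraction [a0; a1, ..., am] of a/b (b > 0), by the
-- Euclidean algorithm; the first argument is fuel (b + 1 suffices).
cfFuel : ℕ → ℕ → ℕ → List ℕ
cfFuel zero    a b       = []
cfFuel (suc f) a zero    = []
cfFuel (suc f) a (suc b) with a % suc b
... | zero  = (a / suc b) ∷ []
... | suc r = (a / suc b) ∷ cfFuel f (suc b) (suc r)

cf : ℕ → ℕ → List ℕ
cf a b = cfFuel (suc b) a b

inv2^ : ℕ → ℚ
inv2^ zero    = 1ℚ
inv2^ (suc k) = ½ ℚ.* inv2^ k

altSum : ℕ → List ℕ → ℚ
altSum s []       = 0ℚ
altSum s (a ∷ as) = inv2^ (s ℕ.+ a) ℚ.- altSum (s ℕ.+ a) as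

-- Minkowski ? of a continued fraction [a0; a1, ..., am]:
-- a0 + 2 Σ_{k=1}^{m} (-1)^{k+1} / 2^{a1+...+ak}
qmCF : List ℕ → ℚ
qmCF []        = 0ℚ
qmCF (a0 ∷ as) = ℕtoℚ a0 ℚ.+ ℕtoℚ 2 ℚ.* altSum 0 as

qm : ℕ × ℕ → ℚ
qm (a , b) = qmCF (cf a b)

qmPath : Path → ℚ
qmPath P = qm (label P)

module Submission where

open import Defs
open import Data.Nat using (ℕ; suc; _≤_)
open import Data.List using (_++_; _∷_; []; replicate)
open import Data.Product using (_×_)
open import Data.Rational using (_+_; _*_; _-_; 1ℚ)
open import Relation.Binary.PropositionalEquality using (_≡_)

open import Data.Nat as N using (zero; _<_; z≤n; s≤s)
open import Data.Nat.Properties as ℕₚ using (≤-refl; <-≤-trans; m≤m+n; m<m+n; m<n+m; +-monoʳ-≤)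
open import Data.Nat.DivMod using (_/_; _%_; m%n<n; [m+kn]%n≡m%n; +-distrib-/-∣ʳ; m*n/n≡m; m<n⇒m/n≡0; m<n⇒m%n≡m)
open import Data.Nat.Divisibility using (divides-refl)
open import Data.Nat.Coprimality using (1-coprimeTo)
import Data.Nat.Coprimality as Coprimality
open import Data.List using (List)
open import Data.Product using (_,_; proj₁; proj₂)
open import Data.Integer using (+_)
open import Data.Rational using (0ℚ; ½)
import Data.Rational as ℚ
import Data.Rational.Properties as ℚₚ
open import Data.Rational.Solver using (module +-*-Solver)
open +-*-Solver
open import Relation.Binary.PropositionalEquality using (refl; sym; trans; cong; cong₂; module ≡-Reasoning)
open ≡-Reasoning

-- The proof follows the continued fraction [a₀; a₁, …, aₘ] of a vertex label
-- a/b through the three kinds of moves.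
--   * Right moves a/b ↦ (a + b)/b add 1 to the integer part a₀ (lemma
--     cf-addMultiple), and ?(x + k) = k + ?(x) (qm-shift).
--   * For a proper fraction a/c the expansion is [0; cf(c/a)] (cf-proper).
--     Left moves a/c ↦ a/(c + a) therefore add 1 to a₁, which multiplies ?
--     by 1/2 (qm-leftShift).
--   * The word L Rⁿ L sends a/b, with c = a + b, to x/(x + c) where
--     x = a + n c; its expansion is [0; 1, n, cf(c/a)] (cf-zigzag), and a
--     direct computation with the alternating sum gives (3) (qmCF-zigzag).

cfRest : ℕ → ℕ → ℕ → List ℕ
cfRest f b zero    = []
cfRest f b (suc r) = cfFuel f b (suc r)

cfFuel-step : ∀ f a b → cfFuel (suc f) a (suc b) ≡ (a / suc b) ∷ cfRest f (suc b) (a % suc b)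
cfFuel-step f a b with a % suc b
... | zero  = refl
... | suc r = refl

cfFuel-fuel : ∀ {f g} a b → b < f → b < g → cfFuel f a b ≡ cfFuel g a b
cfRest-fuel : ∀ {f g} b r → r < b → b ≤ f → b ≤ g → cfRest f b r ≡ cfRest g b r

cfFuel-fuel {suc f} {suc g} a zero    _         _         = refl
cfFuel-fuel {suc f} {suc g} a (suc b) (s≤s b<f) (s≤s b<g) = begin
  cfFuel (suc f) a (suc b)                    ≡⟨ cfFuel-step f a b ⟩
  (a / suc b) ∷ cfRest f (suc b) (a % suc b)  ≡⟨ cong (a / suc b ∷_) (cfRest-fuel (suc b) (a % suc b) (m%n<n a (suc b)) b<f b<g) ⟩
  (a / suc b) ∷ cfRest g (suc b) (a % suc b)  ≡⟨ sym (cfFuel-step g a b) ⟩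
  cfFuel (suc g) a (suc b)                    ∎

cfRest-fuel b zero    _   _   _   = refl
cfRest-fuel b (suc r) r<b b≤f b≤g = cfFuel-fuel b (suc r) (<-≤-trans r<b b≤f) (<-≤-trans r<b b≤g)

addHead : ℕ → List ℕ → List ℕ
addHead k []      = []
addHead k (h ∷ t) = (k N.+ h) ∷ t

cf-addMultiple : ∀ a k {b} → 0 < b → cf (a N.+ k N.* b) b ≡ addHead k (cf a b)
cf-addMultiple a k {suc b} _ = begin
  cf (a N.+ k N.* B) B                                         ≡⟨ cfFuel-step B (a N.+ k N.* B) b ⟩
  (a N.+ k N.* B) / B ∷ cfRest B B ((a N.+ k N.* B) % B)       ≡⟨ cong₂ (λ q r → q ∷ cfRest B B r) quotient ([m+kn]%n≡m%n a k B) ⟩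
  k N.+ a / B ∷ cfRest B B (a % B)                             ≡⟨ cong (addHead k) (sym (cfFuel-step B a b)) ⟩
  addHead k (cf a B)                                           ∎
  where
  B : ℕ
  B = suc b
  quotient : (a N.+ k N.* B) / B ≡ k N.+ a / B
  quotient = trans (+-distrib-/-∣ʳ a (divides-refl k))
                   (trans (cong (a / B N.+_) (m*n/n≡m k B)) (ℕₚ.+-comm (a / B) k))

cf-proper : ∀ {a c} → 0 < a → a < c → cf a c ≡ 0 ∷ cf c a
cf-proper {suc a} {suc c} _ a<c = begin
  cf (suc a) (suc c)                                         ≡⟨ cfFuel-step (suc c) (suc a) c ⟩
  suc a / suc c ∷ cfRest (suc c) (suc c) (suc a % suc c)     ≡⟨ cong₂ (λ q r → q ∷ cfRest (suc c) (suc c) r) (m<n⇒m/n≡0 a<c) (m<n⇒m%n≡m a<c) ⟩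
  0 ∷ cfFuel (suc c) (suc c) (suc a)                         ≡⟨ cong (0 ∷_) (cfFuel-fuel (suc c) (suc a) a<c ≤-refl) ⟩
  0 ∷ cf (suc c) (suc a)                                     ∎

-- The vertex x/(x + c), x = a + n c, reached from a/b by L Rⁿ L has
-- expansion [0; 1, n, cf(c/a)].
cf-zigzag : ∀ {a c} n → 0 < a → a < c → 1 ≤ n →
  let x = a N.+ n N.* c in cf x (x N.+ c) ≡ 0 ∷ 1 ∷ n ∷ cf c a
cf-zigzag {a} {c} n@(suc m) a>0 a<c _ = begin
  cf x (x N.+ c)                ≡⟨ cf-proper x>0 (m<m+n x c>0) ⟩
  0 ∷ cf (x N.+ c) x            ≡⟨ cong (λ y → 0 ∷ cf y x) x+c≡c+1x ⟩
  0 ∷ cf (c N.+ 1 N.* x) x      ≡⟨ cong (0 ∷_) (cf-addMultiple c 1 x>0) ⟩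
  0 ∷ addHead 1 (cf c x)        ≡⟨ cong (λ l → 0 ∷ addHead 1 l) (cf-proper c>0 c<x) ⟩
  0 ∷ 1 ∷ cf x c                ≡⟨ cong (λ l → 0 ∷ 1 ∷ l) (cf-addMultiple a n c>0) ⟩
  0 ∷ 1 ∷ addHead n (cf a c)    ≡⟨ cong (λ l → 0 ∷ 1 ∷ addHead n l) (cf-proper a>0 a<c) ⟩
  0 ∷ 1 ∷ (n N.+ 0) ∷ cf c a    ≡⟨ cong (λ k → 0 ∷ 1 ∷ k ∷ cf c a) (ℕₚ.+-identityʳ n) ⟩
  0 ∷ 1 ∷ n ∷ cf c a            ∎
  where
  x : ℕ
  x = a N.+ n N.* c
  c>0 : 0 < c
  c>0 = <-≤-trans a>0 (ℕₚ.<⇒≤ a<c)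
  x>0 : 0 < x
  x>0 = <-≤-trans a>0 (m≤m+n a (n N.* c))
  c<x : c < x
  c<x = <-≤-trans (m<n+m c a>0) (+-monoʳ-≤ a (m≤m+n c (m N.* c)))
  x+c≡c+1x : x N.+ c ≡ c N.+ 1 N.* x
  x+c≡c+1x = trans (ℕₚ.+-comm x c) (cong (c N.+_) (sym (ℕₚ.*-identityˡ x)))

-- The embedding ℕ → ℚ is additive. Its values n/1 are already in lowest
-- terms, which makes 1 + n/1 compute to (n + 1)/1.
ℕtoℚ-normal : ∀ n → ℕtoℚ n ≡ ℚ.mkℚ (+ n) 0 (Coprimality.sym (1-coprimeTo n))
ℕtoℚ-normal n = ℚₚ.normalize-coprime (Coprimality.sym (1-coprimeTo n))

ℕtoℚ-suc : ∀ n → ℕtoℚ (suc n) ≡ 1ℚ + ℕtoℚ n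
ℕtoℚ-suc zero        = refl
ℕtoℚ-suc n@(suc n-1) = sym (begin
  1ℚ + ℕtoℚ n                                                   ≡⟨ cong (λ q → 1ℚ + q) (ℕtoℚ-normal n) ⟩
  1ℚ + ℚ.mkℚ (+ n) 0 (Coprimality.sym (1-coprimeTo n))          ≡⟨ cong (λ k → (+ suc k) ℚ./ 1) (ℕₚ.*-identityʳ n) ⟩
  ℕtoℚ (suc n)                                                  ∎)

ℕtoℚ-+ : ∀ m n → ℕtoℚ (m N.+ n) ≡ ℕtoℚ m + ℕtoℚ n
ℕtoℚ-+ zero    n = sym (ℚₚ.+-identityˡ (ℕtoℚ n))
ℕtoℚ-+ (suc m) n = begin
  ℕtoℚ (suc (m N.+ n))      ≡⟨ ℕtoℚ-suc (m N.+ n) ⟩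
  1ℚ + ℕtoℚ (m N.+ n)       ≡⟨ cong (λ q → 1ℚ + q) (ℕtoℚ-+ m n) ⟩
  1ℚ + (ℕtoℚ m + ℕtoℚ n)    ≡⟨ sym (ℚₚ.+-assoc 1ℚ (ℕtoℚ m) (ℕtoℚ n)) ⟩
  (1ℚ + ℕtoℚ m) + ℕtoℚ n    ≡⟨ cong (_+ ℕtoℚ n) (sym (ℕtoℚ-suc m)) ⟩
  ℕtoℚ (suc m) + ℕtoℚ n     ∎

inv2^-+ : ∀ s a → inv2^ (s N.+ a) ≡ inv2^ s * inv2^ a
inv2^-+ zero    a = sym (ℚₚ.*-identityˡ (inv2^ a))
inv2^-+ (suc s) a = trans (cong (½ *_) (inv2^-+ s a)) (sym (ℚₚ.*-assoc ½ (inv2^ s) (inv2^ a)))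

altSum-shift : ∀ s l → altSum s l ≡ inv2^ s * altSum 0 l
altSum-shift s []       = sym (ℚₚ.*-zeroʳ (inv2^ s))
altSum-shift s (a ∷ as) = begin
  inv2^ (s N.+ a) - altSum (s N.+ a) as                ≡⟨ cong₂ _-_ (inv2^-+ s a) (trans (altSum-shift (s N.+ a) as) (cong (_* altSum 0 as) (inv2^-+ s a))) ⟩
  inv2^ s * inv2^ a - inv2^ s * inv2^ a * altSum 0 as  ≡⟨ solve 3 (λ I J Z → I :* J :- I :* J :* Z := I :* (J :- J :* Z)) refl (inv2^ s) (inv2^ a) (altSum 0 as) ⟩
  inv2^ s * (inv2^ a - inv2^ a * altSum 0 as)          ≡⟨ cong (λ z → inv2^ s * (inv2^ a - z)) (sym (altSum-shift a as)) ⟩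
  inv2^ s * altSum 0 (a ∷ as)                          ∎

qmCF-addHead : ∀ k h t → qmCF (addHead k (h ∷ t)) ≡ ℕtoℚ k + qmCF (h ∷ t)
qmCF-addHead k h t = begin
  ℕtoℚ (k N.+ h) + ℕtoℚ 2 * altSum 0 t    ≡⟨ cong (_+ ℕtoℚ 2 * altSum 0 t) (ℕtoℚ-+ k h) ⟩
  ℕtoℚ k + ℕtoℚ h + ℕtoℚ 2 * altSum 0 t   ≡⟨ ℚₚ.+-assoc (ℕtoℚ k) (ℕtoℚ h) _ ⟩
  ℕtoℚ k + qmCF (h ∷ t)                   ∎

-- ?([0; a₁ + k, a₂, …]) = 2^{-k} ?([0; a₁, a₂, …]); the alternating sum of
-- addHead k l is by definition the one of l started at offset k.
qmCF-scale : ∀ k l → qmCF (0 ∷ addHead k l) ≡ inv2^ k * qmCF (0 ∷ l)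
qmCF-scale k l = begin
  ℕtoℚ 0 + ℕtoℚ 2 * altSum 0 (addHead k l)     ≡⟨ cong (λ z → ℕtoℚ 0 + ℕtoℚ 2 * z) (altSum-offset l) ⟩
  ℕtoℚ 0 + ℕtoℚ 2 * (inv2^ k * altSum 0 l)     ≡⟨ solve 2 (λ I A → con 0ℚ :+ con (ℕtoℚ 2) :* (I :* A) := I :* (con 0ℚ :+ con (ℕtoℚ 2) :* A)) refl (inv2^ k) (altSum 0 l) ⟩
  inv2^ k * (ℕtoℚ 0 + ℕtoℚ 2 * altSum 0 l)     ∎
  where
  -- altSum 0 (addHead k l) unfolds to altSum k l once l is split.
  altSum-offset : ∀ l → altSum 0 (addHead k l) ≡ inv2^ k * altSum 0 l
  altSum-offset []      = altSum-shift k []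
  altSum-offset (h ∷ t) = altSum-shift k (h ∷ t)

qmCF-zigzag : ∀ n l → qmCF (0 ∷ 1 ∷ n ∷ l) ≡ (1ℚ - inv2^ n) + inv2^ (suc n) * qmCF (0 ∷ l)
qmCF-zigzag n l = begin
  qmCF (0 ∷ 1 ∷ n ∷ l)
    ≡⟨⟩
  ℕtoℚ 0 + ℕtoℚ 2 * (inv2^ 1 - (inv2^ (suc n) - altSum (suc n) l))
    ≡⟨ cong (λ z → ℕtoℚ 0 + ℕtoℚ 2 * (inv2^ 1 - (inv2^ (suc n) - z))) (altSum-shift (suc n) l) ⟩
  ℕtoℚ 0 + ℕtoℚ 2 * (inv2^ 1 - (inv2^ (suc n) - inv2^ (suc n) * altSum 0 l))
    ≡⟨ solve 2 (λ I A → con 0ℚ :+ con (ℕtoℚ 2) :* (con ½ :* con 1ℚ :- (con ½ :* I :- con ½ :* I :* A))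
                     := (con 1ℚ :- I) :+ con ½ :* I :* (con 0ℚ :+ con (ℕtoℚ 2) :* A)) refl (inv2^ n) (altSum 0 l) ⟩
  (1ℚ - inv2^ n) + inv2^ (suc n) * (ℕtoℚ 0 + ℕtoℚ 2 * altSum 0 l)
    ∎

qm-shift : ∀ a k {b} → 0 < b → qm (a N.+ k N.* b , b) ≡ ℕtoℚ k + qm (a , b)
qm-shift a k {suc b} b>0 = begin
  qmCF (cf (a N.+ k N.* suc b) (suc b))              ≡⟨ cong qmCF (cf-addMultiple a k b>0) ⟩
  qmCF (addHead k (cf a (suc b)))                    ≡⟨ cong (λ l → qmCF (addHead k l)) (cfFuel-step (suc b) a b) ⟩
  qmCF (addHead k (a / suc b ∷ tail))                ≡⟨ qmCF-addHead k (a / suc b) tail ⟩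
  ℕtoℚ k + qmCF (a / suc b ∷ tail)                   ≡⟨ cong (λ l → ℕtoℚ k + qmCF l) (sym (cfFuel-step (suc b) a b)) ⟩
  ℕtoℚ k + qm (a , suc b)                            ∎
  where
  tail : List ℕ
  tail = cfRest (suc b) (suc b) (a % suc b)

qm-leftShift : ∀ {a c} k → 0 < a → a < c → qm (a , c N.+ k N.* a) ≡ inv2^ k * qm (a , c)
qm-leftShift {a} {c} k a>0 a<c = begin
  qmCF (cf a (c N.+ k N.* a))          ≡⟨ cong qmCF (cf-proper a>0 (<-≤-trans a<c (m≤m+n c (k N.* a)))) ⟩
  qmCF (0 ∷ cf (c N.+ k N.* a) a)      ≡⟨ cong (λ l → qmCF (0 ∷ l)) (cf-addMultiple c k a>0) ⟩
  qmCF (0 ∷ addHead k (cf c a))        ≡⟨ qmCF-scale k (cf c a) ⟩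
  inv2^ k * qmCF (0 ∷ cf c a)          ≡⟨ cong (λ l → inv2^ k * qmCF l) (sym (cf-proper a>0 a<c)) ⟩
  inv2^ k * qm (a , c)                 ∎

labelFrom-++ : ∀ v P Q → labelFrom v (P ++ Q) ≡ labelFrom (labelFrom v P) Q
labelFrom-++ v []      Q = refl
labelFrom-++ v (x ∷ P) Q = labelFrom-++ (step v x) P Q

qmPath-++ : ∀ P Q → qmPath (P ++ Q) ≡ qm (labelFrom (label P) Q)
qmPath-++ P Q = cong qm (labelFrom-++ (1 , 1) P Q)

labelFrom-Rⁿ : ∀ n a b → labelFrom (a , b) (replicate n R) ≡ (a N.+ n N.* b , b)
labelFrom-Rⁿ zero    a b = cong (_, b) (sym (ℕₚ.+-identityʳ a))
labelFrom-Rⁿ (suc n) a b = trans (labelFrom-Rⁿ n (a N.+ b) b) (cong (_, b) (ℕₚ.+-assoc a b (n N.* b)))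

labelFrom-Lⁿ : ∀ n a b → labelFrom (a , b) (replicate n L) ≡ (a , b N.+ n N.* a)
labelFrom-Lⁿ zero    a b = cong (a ,_) (sym (ℕₚ.+-identityʳ b))
labelFrom-Lⁿ (suc n) a b = trans (labelFrom-Lⁿ n a (a N.+ b))
  (cong (a ,_) (trans (cong (N._+ n N.* a) (ℕₚ.+-comm a b)) (ℕₚ.+-assoc b a (n N.* a))))

Positive : ℕ × ℕ → Set
Positive (a , b) = 0 < a × 0 < b

labelFrom-positive : ∀ v P → Positive v → Positive (labelFrom v P)
labelFrom-positive v []      pos         = pos
labelFrom-positive (a , b) (L ∷ P) (a>0 , b>0) =
  labelFrom-positive (a , a N.+ b) P (a>0 , <-≤-trans a>0 (m≤m+n a b))
labelFrom-positive (a , b) (R ∷ P) (a>0 , b>0) =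
  labelFrom-positive (a N.+ b , b) P (<-≤-trans a>0 (m≤m+n a b) , b>0)

label-positive : ∀ P → Positive (label P)
label-positive P = labelFrom-positive (1 , 1) P (s≤s z≤n , s≤s z≤n)

rightTurns : ∀ n {a b} → 0 < b → qm (labelFrom (a , b) (replicate n R)) ≡ ℕtoℚ n + qm (a , b)
rightTurns n {a} {b} b>0 = trans (cong qm (labelFrom-Rⁿ n a b)) (qm-shift a n b>0)

leftTurns : ∀ n {a b} → 0 < a → 0 < b →
  qm (labelFrom (a , b) (replicate (suc n) L)) ≡ inv2^ n * qm (labelFrom (a , b) (L ∷ []))
leftTurns n {a} {b} a>0 b>0 = trans (cong qm (labelFrom-Lⁿ n a (a N.+ b))) (qm-leftShift n a>0 (m<m+n a b>0))

zigzag : ∀ n {a b} → 0 < a → 0 < b → 1 ≤ n →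
  qm (labelFrom (a , b) (L ∷ replicate n R ++ L ∷ []))
    ≡ (1ℚ - inv2^ n) + inv2^ (suc n) * qm (labelFrom (a , b) (L ∷ []))
zigzag n {a} {b} a>0 b>0 1≤n = begin
  qm (labelFrom (a , c) (replicate n R ++ L ∷ []))    ≡⟨ cong qm labelAfterZigzag ⟩
  qmCF (cf x (x N.+ c))                              ≡⟨ cong qmCF (cf-zigzag n a>0 a<c 1≤n) ⟩
  qmCF (0 ∷ 1 ∷ n ∷ cf c a)                          ≡⟨ qmCF-zigzag n (cf c a) ⟩
  (1ℚ - inv2^ n) + inv2^ (suc n) * qmCF (0 ∷ cf c a) ≡⟨ cong (λ l → (1ℚ - inv2^ n) + inv2^ (suc n) * qmCF l) (sym (cf-proper a>0 a<c)) ⟩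
  (1ℚ - inv2^ n) + inv2^ (suc n) * qm (a , c)        ∎
  where
  c x : ℕ
  c = a N.+ b
  x = a N.+ n N.* c
  a<c : a < c
  a<c = m<m+n a b>0
  labelAfterZigzag : labelFrom (a , c) (replicate n R ++ L ∷ []) ≡ (x , x N.+ c)
  labelAfterZigzag = trans (labelFrom-++ (a , c) (replicate n R) (L ∷ []))
                           (cong (λ v → labelFrom v (L ∷ [])) (labelFrom-Rⁿ n a c))

mainTheorem6 : (P : Path) (n : ℕ) → 1 ≤ n →
    (qmPath (P ++ replicate n R) ≡ ℕtoℚ n + qmPath P)
    × (qmPath (P ++ replicate (suc n) L) ≡ inv2^ n * qmPath (P ++ L ∷ []))
    × (qmPath (P ++ (L ∷ replicate n R ++ L ∷ [])) ≡ (1ℚ - inv2^ n) + inv2^ (suc n) * qmPath (P ++ L ∷ []))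
mainTheorem6 P n 1≤n =
    trans (qmPath-++ P (replicate n R)) (rightTurns n b>0)
  , trans (qmPath-++ P (replicate (suc n) L))
      (trans (leftTurns n a>0 b>0) (cong (inv2^ n *_) (sym (qmPath-++ P (L ∷ [])))))
  , trans (qmPath-++ P (L ∷ replicate n R ++ L ∷ []))
      (trans (zigzag n a>0 b>0 1≤n)
             (cong (λ q → (1ℚ - inv2^ n) + inv2^ (suc n) * q) (sym (qmPath-++ P (L ∷ [])))))
  where
  a>0 : 0 < proj₁ (label P)
  a>0 = proj₁ (label-positive P)
  b>0 : 0 < proj₂ (label P)
  b>0 = proj₂ (label-positive P)
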